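{- A jointly mono span $X_1\xleftarrow{\pi_1}B\xrightarrow{\pi_2}X_2$ between $T$-coalgebras $(X_1,\gamma_1)$ and $(X_2,\gamma_2)$ is a $\rho$-bisimulation if and only if there exists a morphism $\delta\colon B\to T^\rho B$ in $\mathcal C$ such that $T^\rho\pi_i\circ\delta=\gamma_i\circ\pi_i$ for $i=1,2$.
   Context: $P\colon\mathcal C\to\mathcal A$, $S\colon\mathcal A\to\mathcal C$ are contravariant functors forming a dual adjunction (natural bijection $\mathcal C(X,SA)\cong\mathcal A(A,PX)$) with units $\eta^{\mathcal C}\colon\mathrm{Id}_{\mathcal C}\to SP$, $\eta^{\mathcal A}\colon\mathrm{Id}_{\mathcal A}\to PS$. $T\colon\mathcal C\to\mathcal C$ is an endofunctor; a $T$-coalgebra is $(X,\gamma)$ with $\gamma\colon X\to TX$. $(L,\rho)$ is a logic: $L\colon\mathcal A\to\mathcal A$, $\rho\colon LP\to PT$ natural; complex algebra $\gamma^*=P\gamma\circ\rho_X$. Standing assumptions: $\mathcal C$ is finitely complete, well-powered, with an $(\mathcal E,\mathrm{Mono})$-factorisation system; $\mathcal A$ has pullbacks or $\mathcal C$ has pushouts. A span $X_1\xleftarrow{\pi_1}B\xrightarrow{\pi_2}X_2$ is jointly mono if $\pi_1h=\pi_1h'$ and $\pi_2h=\pi_2h'$ imply $h=h'$; its dual span $(\bar B,\bar\pi_1,\bar\pi_2)$ is the pullback in $\mathcal A$ of $PX_1\xrightarrow{P\pi_1}PB\xleftarrow{P\pi_2}PX_2$; it is a $\rho$-bisimulation between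 $(X_1,\gamma_1),(X_2,\gamma_2)$ if $P\pi_1\circ\gamma_1^*\circ L\bar\pi_1=P\pi_2\circ\gamma_2^*\circ L\bar\pi_2$. Relation lifting: for $i=1,2$ let $\sigma_i=SL\bar\pi_i\circ S\rho_{X_i}\circ\eta^{\mathcal C}_{TX_i}\colon TX_i\to SL\bar B$, and let $(T^\rho B,T^\rho\pi_1,T^\rho\pi_2)$, with $T^\rho\pi_i\colon T^\rho B\to TX_i$, be the pullback in $\mathcal C$ of $TX_1\xrightarrow{\sigma_1}SL\bar B\xleftarrow{\sigma_2}TX_2$. -}

module Defs where

open import Level using (Level; _⊔_; suc)
open import Data.Product using (Σ; _×_; _,_; ∃; ∃-syntax)
open import Data.Sum using (_⊎_)
open import Relation.Binary.Structures using (IsEquivalence)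

record Category (o ℓ e : Level) : Set (suc (o ⊔ ℓ ⊔ e)) where
  infixr 9 _∘_
  infix  4 _≈_
  field
    Obj   : Set o
    Hom   : Obj → Obj → Set ℓ
    _≈_   : ∀ {X Y} → Hom X Y → Hom X Y → Set e
    ≈-equiv : ∀ {X Y} → IsEquivalence (_≈_ {X} {Y})
    id    : ∀ {X} → Hom X X
    _∘_   : ∀ {X Y Z} → Hom Y Z → Hom X Y → Hom X Z
    assoc : ∀ {W X Y Z} {f : Hom W X} {g : Hom X Y} {h : Hom Y Z} →
            (h ∘ g) ∘ f ≈ h ∘ (g ∘ f)
    identityˡ : ∀ {X Y} {f : Hom X Y} → id ∘ f ≈ f
    identityʳ : ∀ {X Y} {f : Hom X Y} → f ∘ id ≈ f
    ∘-resp-≈  : ∀ {X Y Z} {f f' : Hom Y Z} {g g' : Hom X Y} →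
                f ≈ f' → g ≈ g' → f ∘ g ≈ f' ∘ g'

module _ {o ℓ e} (C : Category o ℓ e) where
  open Category C

  Mono : ∀ {X Y} → Hom X Y → Set (o ⊔ ℓ ⊔ e)
  Mono {X} f = ∀ {W} (g h : Hom W X) → f ∘ g ≈ f ∘ h → g ≈ h

  Iso : ∀ {X Y} → Hom X Y → Set (ℓ ⊔ e)
  Iso {X} {Y} f = Σ (Hom Y X) λ g → (g ∘ f ≈ id) × (f ∘ g ≈ id)

  record IsPullback {X Y Z P : Obj} (f : Hom X Z) (g : Hom Y Z)
                    (p₁ : Hom P X) (p₂ : Hom P Y) : Set (o ⊔ ℓ ⊔ e) where
    field
      commute   : f ∘ p₁ ≈ g ∘ p₂
      universal : ∀ {Q} (q₁ : Hom Q X) (q₂ : Hom Q Y) → f ∘ q₁ ≈ g ∘ q₂ →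
                  Σ (Hom Q P) λ u → (p₁ ∘ u ≈ q₁) × (p₂ ∘ u ≈ q₂)
      unique    : ∀ {Q} (u v : Hom Q P) → p₁ ∘ u ≈ p₁ ∘ v → p₂ ∘ u ≈ p₂ ∘ v → u ≈ v

  record IsPushout {X Y Z Q : Obj} (f : Hom Z X) (g : Hom Z Y)
                   (q₁ : Hom X Q) (q₂ : Hom Y Q) : Set (o ⊔ ℓ ⊔ e) where
    field
      commute   : q₁ ∘ f ≈ q₂ ∘ g
      universal : ∀ {R} (r₁ : Hom X R) (r₂ : Hom Y R) → r₁ ∘ f ≈ r₂ ∘ g →
                  Σ (Hom Q R) λ u → (u ∘ q₁ ≈ r₁) × (u ∘ q₂ ≈ r₂)
      unique    : ∀ {R} (u v : Hom Q R) → u ∘ q₁ ≈ v ∘ q₁ → u ∘ q₂ ≈ v ∘ q₂ → u ≈ v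

  HasPullbacks : Set (o ⊔ ℓ ⊔ e)
  HasPullbacks = ∀ {X Y Z} (f : Hom X Z) (g : Hom Y Z) →
    Σ Obj λ P → Σ (Hom P X) λ p₁ → Σ (Hom P Y) λ p₂ → IsPullback f g p₁ p₂

  HasPushouts : Set (o ⊔ ℓ ⊔ e)
  HasPushouts = ∀ {X Y Z} (f : Hom Z X) (g : Hom Z Y) →
    Σ Obj λ Q → Σ (Hom X Q) λ q₁ → Σ (Hom Y Q) λ q₂ → IsPushout f g q₁ q₂

  IsTerminal : Obj → Set (o ⊔ ℓ ⊔ e)
  IsTerminal ⊤ = ∀ X → Σ (Hom X ⊤) λ t → ∀ (t' : Hom X ⊤) → t' ≈ t

  FinitelyComplete : Set (o ⊔ ℓ ⊔ e)
  FinitelyComplete = (Σ Obj IsTerminal) × HasPullbacks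

  -- well-powered: the subobjects of every object form a (small) set,
  -- i.e. there is an ℓ-small family of monos into X such that every
  -- mono into X is isomorphic over X to a member of the family
  WellPowered : Set (suc ℓ ⊔ o ⊔ e)
  WellPowered = ∀ (X : Obj) →
    Σ (Set ℓ) λ I → Σ (I → Obj) λ D → Σ (∀ i → Hom (D i) X) λ m →
      (∀ i → Mono (m i)) ×
      (∀ {Y} (n : Hom Y X) → Mono n →
         Σ I λ i → Σ (Hom Y (D i)) λ k → Iso k × (m i ∘ k ≈ n))

  record IsEMonoFactorisation {q} (E : ∀ {X Y} → Hom X Y → Set q)
         : Set (o ⊔ ℓ ⊔ e ⊔ q) where
    field
      E-resp-≈  : ∀ {X Y} {f g : Hom X Y} → f ≈ g → E f → E g
      E-iso     : ∀ {X Y} (f : Hom X Y) → Iso f → E f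
      E-∘       : ∀ {X Y Z} {f : Hom X Y} {g : Hom Y Z} → E f → E g → E (g ∘ f)
      factorise : ∀ {X Y} (f : Hom X Y) →
                  Σ Obj λ M → Σ (Hom X M) λ ε → Σ (Hom M Y) λ m →
                    E ε × Mono m × (m ∘ ε ≈ f)
      diagonal  : ∀ {A B C D} {ε : Hom A B} {m : Hom C D}
                    (u : Hom A C) (v : Hom B D) → E ε → Mono m →
                    v ∘ ε ≈ m ∘ u →
                    Σ (Hom B C) λ d → (d ∘ ε ≈ u) × (m ∘ d ≈ v) ×
                      (∀ (d' : Hom B C) → d' ∘ ε ≈ u → m ∘ d' ≈ v → d' ≈ d)

record Functor {o ℓ e o' ℓ' e'} (C : Category o ℓ e) (D : Category o' ℓ' e')
       : Set (o ⊔ ℓ ⊔ e ⊔ o' ⊔ ℓ' ⊔ e') where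
  private
    module C = Category C
    module D = Category D
  field
    F₀ : C.Obj → D.Obj
    F₁ : ∀ {X Y} → C.Hom X Y → D.Hom (F₀ X) (F₀ Y)
    identity : ∀ {X} → F₁ (C.id {X}) D.≈ D.id
    homomorphism : ∀ {X Y Z} {f : C.Hom X Y} {g : C.Hom Y Z} →
                   F₁ (g C.∘ f) D.≈ F₁ g D.∘ F₁ f
    F-resp-≈ : ∀ {X Y} {f g : C.Hom X Y} → f C.≈ g → F₁ f D.≈ F₁ g

record ContraFunctor {o ℓ e o' ℓ' e'} (C : Category o ℓ e) (D : Category o' ℓ' e')
       : Set (o ⊔ ℓ ⊔ e ⊔ o' ⊔ ℓ' ⊔ e') where
  private
    module C = Category C
    module D = Category D
  field
    F₀ : C.Obj → D.Obj
    F₁ : ∀ {X Y} → C.Hom X Y → D.Hom (F₀ Y) (F₀ X)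
    identity : ∀ {X} → F₁ (C.id {X}) D.≈ D.id
    homomorphism : ∀ {X Y Z} {f : C.Hom X Y} {g : C.Hom Y Z} →
                   F₁ (g C.∘ f) D.≈ F₁ f D.∘ F₁ g
    F-resp-≈ : ∀ {X Y} {f g : C.Hom X Y} → f C.≈ g → F₁ f D.≈ F₁ g

module _ {o ℓ e o' ℓ' e'} {C : Category o ℓ e} {A : Category o' ℓ' e'} where
  private
    module C = Category C
    module A = Category A

  record DualAdjunction (P : ContraFunctor C A) (S : ContraFunctor A C)
         : Set (o ⊔ ℓ ⊔ e ⊔ o' ⊔ ℓ' ⊔ e') where
    private
      module P = ContraFunctor P
      module S = ContraFunctor S
    field
      φ : ∀ {X a} → C.Hom X (S.F₀ a) → A.Hom a (P.F₀ X)
      ψ : ∀ {X a} → A.Hom a (P.F₀ X) → C.Hom X (S.F₀ a)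
      φ-resp-≈ : ∀ {X a} {f g : C.Hom X (S.F₀ a)} → f C.≈ g → φ f A.≈ φ g
      ψ-resp-≈ : ∀ {X a} {f g : A.Hom a (P.F₀ X)} → f A.≈ g → ψ f C.≈ ψ g
      ψφ : ∀ {X a} (f : C.Hom X (S.F₀ a)) → ψ (φ f) C.≈ f
      φψ : ∀ {X a} (g : A.Hom a (P.F₀ X)) → φ (ψ g) A.≈ g
      φ-natural-X : ∀ {X' X a} (h : C.Hom X' X) (f : C.Hom X (S.F₀ a)) →
                    φ (f C.∘ h) A.≈ P.F₁ h A.∘ φ f
      φ-natural-A : ∀ {X a' a} (k : A.Hom a' a) (f : C.Hom X (S.F₀ a)) →
                    φ (S.F₁ k C.∘ f) A.≈ φ f A.∘ k

    ηC : ∀ X → C.Hom X (S.F₀ (P.F₀ X))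
    ηC X = ψ (A.id {P.F₀ X})

    ηA : ∀ a → A.Hom a (P.F₀ (S.F₀ a))
    ηA a = φ (C.id {S.F₀ a})

module _ {o ℓ e o' ℓ' e'} {C : Category o ℓ e} {A : Category o' ℓ' e'}
         (P : ContraFunctor C A) (T : Functor C C) (L : Functor A A) where
  private
    module C = Category C
    module A = Category A
    module P = ContraFunctor P
    module T = Functor T
    module L = Functor L

  record LogicNat : Set (o ⊔ ℓ ⊔ e ⊔ o' ⊔ ℓ' ⊔ e') where
    field
      ρ : ∀ X → A.Hom (L.F₀ (P.F₀ X)) (P.F₀ (T.F₀ X))
      natural : ∀ {X Y} (f : C.Hom X Y) →
                ρ X A.∘ L.F₁ (P.F₁ f) A.≈ P.F₁ (T.F₁ f) A.∘ ρ Y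

  complexAlg : (ρ : LogicNat) → ∀ {X} → C.Hom X (T.F₀ X) →
               A.Hom (L.F₀ (P.F₀ X)) (P.F₀ X)
  complexAlg ρ {X} γ = P.F₁ γ A.∘ LogicNat.ρ ρ X

  IsRhoBisimulation : (ρ : LogicNat) → ∀ {X₁ X₂ B B̄} →
    (γ₁ : C.Hom X₁ (T.F₀ X₁)) (γ₂ : C.Hom X₂ (T.F₀ X₂)) →
    (π₁ : C.Hom B X₁) (π₂ : C.Hom B X₂) →
    (π̄₁ : A.Hom B̄ (P.F₀ X₁)) (π̄₂ : A.Hom B̄ (P.F₀ X₂)) → Set e'
  IsRhoBisimulation ρ γ₁ γ₂ π₁ π₂ π̄₁ π̄₂ =
    P.F₁ π₁ A.∘ complexAlg ρ γ₁ A.∘ L.F₁ π̄₁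
      A.≈ P.F₁ π₂ A.∘ complexAlg ρ γ₂ A.∘ L.F₁ π̄₂

module _ {o ℓ e} (C : Category o ℓ e) where
  open Category C
  JointlyMono : ∀ {X₁ X₂ B} → Hom B X₁ → Hom B X₂ → Set (o ⊔ ℓ ⊔ e)
  JointlyMono {B = B} π₁ π₂ = ∀ {W} (h h' : Hom W B) →
    π₁ ∘ h ≈ π₁ ∘ h' → π₂ ∘ h ≈ π₂ ∘ h' → h ≈ h'

module _ {o ℓ e o' ℓ' e'} {C : Category o ℓ e} {A : Category o' ℓ' e'}
         {P : ContraFunctor C A} {S : ContraFunctor A C}
         (adj : DualAdjunction P S) (T : Functor C C) (L : Functor A A)
         (ρ : LogicNat P T L) where
  private
    module C = Category C
    module P = ContraFunctor P
    module S = ContraFunctor S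
    module T = Functor T
    module L = Functor L

  liftσ : ∀ {X B̄} → Category.Hom A B̄ (P.F₀ X) →
          C.Hom (T.F₀ X) (S.F₀ (L.F₀ B̄))
  liftσ {X} π̄ = S.F₁ (L.F₁ π̄) C.∘ S.F₁ (LogicNat.ρ ρ X) C.∘
                DualAdjunction.ηC adj (T.F₀ X)

-- The transpose of σᵢ under the dual adjunction is ρ_{Xᵢ} ∘ L π̄ᵢ, so by
-- naturality the transpose of σᵢ ∘ γᵢ ∘ πᵢ is P πᵢ ∘ γᵢ* ∘ L π̄ᵢ, one side of
-- the bisimulation equation. Transposition is bijective, hence the span is a
-- ρ-bisimulation iff σ₁ ∘ γ₁ ∘ π₁ ≈ σ₂ ∘ γ₂ ∘ π₂, which by the universal
-- property of the pullback T^ρ B says exactly that γᵢ ∘ πᵢ factor through it.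
module Submission where

open import Defs
open import Level using (Level)
open import Data.Product using (Σ; _×_; _,_)
open import Data.Sum using (_⊎_)
open import Function.Bundles using (_⇔_; mk⇔)
open import Function.Construct.Composition using (_⇔-∘_)
open import Relation.Binary.Bundles using (Setoid)
open import Relation.Binary.Structures using (IsEquivalence)
import Relation.Binary.Reasoning.Setoid as SetoidReasoning

module _ {o ℓ e} (C : Category o ℓ e) where
  open Category C

  homSetoid : Obj → Obj → Setoid ℓ e
  homSetoid X Y = record { Carrier = Hom X Y ; _≈_ = _≈_ ; isEquivalence = ≈-equiv }

  IsPullback-factors⇔commutes :
    ∀ {X Y Z Q R} {f : Hom X Z} {g : Hom Y Z} {p₁ : Hom R X} {p₂ : Hom R Y} →
    IsPullback C f g p₁ p₂ → (q₁ : Hom Q X) (q₂ : Hom Q Y) →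
    f ∘ q₁ ≈ g ∘ q₂ ⇔ Σ (Hom Q R) (λ u → p₁ ∘ u ≈ q₁ × p₂ ∘ u ≈ q₂)
  IsPullback-factors⇔commutes {f = f} {g} {p₁} {p₂} pb q₁ q₂ =
    mk⇔ (universal q₁ q₂) commutes-through
    where
      open IsPullback pb
      module HomEq {X Y} = IsEquivalence (≈-equiv {X} {Y})
      commutes-through : Σ _ (λ u → p₁ ∘ u ≈ q₁ × p₂ ∘ u ≈ q₂) → f ∘ q₁ ≈ g ∘ q₂
      commutes-through (u , p₁u≈q₁ , p₂u≈q₂) = begin
        f ∘ q₁         ≈⟨ ∘-resp-≈ HomEq.refl (HomEq.sym p₁u≈q₁) ⟩
        f ∘ (p₁ ∘ u)   ≈⟨ HomEq.sym assoc ⟩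
        (f ∘ p₁) ∘ u   ≈⟨ ∘-resp-≈ commute HomEq.refl ⟩
        (g ∘ p₂) ∘ u   ≈⟨ assoc ⟩
        g ∘ (p₂ ∘ u)   ≈⟨ ∘-resp-≈ HomEq.refl p₂u≈q₂ ⟩
        g ∘ q₂         ∎
        where open SetoidReasoning (homSetoid _ _)

module _ {o ℓ e o' ℓ' e'} {C : Category o ℓ e} {A : Category o' ℓ' e'}
         {P : ContraFunctor C A} {S : ContraFunctor A C}
         (adj : DualAdjunction P S) where
  private
    module C = Category C
    module A = Category A
    module P = ContraFunctor P
    module S = ContraFunctor S
    module CE {X Y} = IsEquivalence (C.≈-equiv {X} {Y})
    module AE {X Y} = IsEquivalence (A.≈-equiv {X} {Y})
  open DualAdjunction adj

  φ-injective : ∀ {X a} {f g : C.Hom X (S.F₀ a)} → φ f A.≈ φ g → f C.≈ g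
  φ-injective {f = f} {g} φf≈φg =
    CE.trans (CE.sym (ψφ f)) (CE.trans (ψ-resp-≈ φf≈φg) (ψφ g))

  module _ (T : Functor C C) (L : Functor A A) (ρ : LogicNat P T L) where
    private
      module T = Functor T
      module L = Functor L
    open LogicNat ρ using () renaming (ρ to ρ₀)

    φ-liftσ : ∀ {X B̄} (π̄ : A.Hom B̄ (P.F₀ X)) →
              φ (liftσ adj T L ρ π̄) A.≈ ρ₀ X A.∘ L.F₁ π̄
    φ-liftσ {X} π̄ = begin
      φ (S.F₁ (L.F₁ π̄) C.∘ S.F₁ (ρ₀ X) C.∘ ηC (T.F₀ X))
        ≈⟨ φ-natural-A (L.F₁ π̄) _ ⟩
      φ (S.F₁ (ρ₀ X) C.∘ ηC (T.F₀ X)) A.∘ L.F₁ π̄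
        ≈⟨ A.∘-resp-≈ (φ-natural-A (ρ₀ X) _) AE.refl ⟩
      (φ (ηC (T.F₀ X)) A.∘ ρ₀ X) A.∘ L.F₁ π̄
        ≈⟨ A.∘-resp-≈ (A.∘-resp-≈ (φψ A.id) AE.refl) AE.refl ⟩
      (A.id A.∘ ρ₀ X) A.∘ L.F₁ π̄
        ≈⟨ A.∘-resp-≈ A.identityˡ AE.refl ⟩
      ρ₀ X A.∘ L.F₁ π̄ ∎
      where open SetoidReasoning (homSetoid A _ _)

    φ-liftσ-∘-coalgebra :
      ∀ {X B B̄} (π̄ : A.Hom B̄ (P.F₀ X)) (γ : C.Hom X (T.F₀ X)) (π : C.Hom B X) →
      φ (liftσ adj T L ρ π̄ C.∘ (γ C.∘ π))
        A.≈ P.F₁ π A.∘ complexAlg P T L ρ γ A.∘ L.F₁ π̄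
    φ-liftσ-∘-coalgebra {X} π̄ γ π = begin
      φ (liftσ adj T L ρ π̄ C.∘ (γ C.∘ π))
        ≈⟨ φ-natural-X (γ C.∘ π) _ ⟩
      P.F₁ (γ C.∘ π) A.∘ φ (liftσ adj T L ρ π̄)
        ≈⟨ A.∘-resp-≈ P.homomorphism (φ-liftσ π̄) ⟩
      (P.F₁ π A.∘ P.F₁ γ) A.∘ (ρ₀ X A.∘ L.F₁ π̄)
        ≈⟨ A.assoc ⟩
      P.F₁ π A.∘ (P.F₁ γ A.∘ (ρ₀ X A.∘ L.F₁ π̄))
        ≈⟨ A.∘-resp-≈ AE.refl (AE.sym A.assoc) ⟩
      P.F₁ π A.∘ (P.F₁ γ A.∘ ρ₀ X) A.∘ L.F₁ π̄ ∎
      where open SetoidReasoning (homSetoid A _ _)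

    IsRhoBisimulation⇔liftσ-commutes :
      ∀ {X₁ X₂ B B̄} (γ₁ : C.Hom X₁ (T.F₀ X₁)) (γ₂ : C.Hom X₂ (T.F₀ X₂))
        (π₁ : C.Hom B X₁) (π₂ : C.Hom B X₂)
        (π̄₁ : A.Hom B̄ (P.F₀ X₁)) (π̄₂ : A.Hom B̄ (P.F₀ X₂)) →
      IsRhoBisimulation P T L ρ γ₁ γ₂ π₁ π₂ π̄₁ π̄₂
        ⇔ liftσ adj T L ρ π̄₁ C.∘ (γ₁ C.∘ π₁) C.≈ liftσ adj T L ρ π̄₂ C.∘ (γ₂ C.∘ π₂)
    IsRhoBisimulation⇔liftσ-commutes γ₁ γ₂ π₁ π₂ π̄₁ π̄₂ = mk⇔
      (λ bisim → φ-injective (AE.trans transpose₁ (AE.trans bisim (AE.sym transpose₂))))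
      (λ square → AE.trans (AE.sym transpose₁) (AE.trans (φ-resp-≈ square) transpose₂))
      where
        transpose₁ = φ-liftσ-∘-coalgebra π̄₁ γ₁ π₁
        transpose₂ = φ-liftσ-∘-coalgebra π̄₂ γ₂ π₂

theorem3p17 :
  ∀ {o ℓ e o' ℓ' e' q : Level}
    (C : Category o ℓ e) (A : Category o' ℓ' e')
    -- standing assumptions
    (C-finComplete : FinitelyComplete C) (C-wellPowered : WellPowered C)
    (E : ∀ {X Y} → Category.Hom C X Y → Set q)
    (fact : IsEMonoFactorisation C E)
    (pb-or-po : HasPullbacks A ⊎ HasPushouts C)
    -- dual adjunction, endofunctor, logic
    (P : ContraFunctor C A) (S : ContraFunctor A C)
    (adj : DualAdjunction P S)
    (T : Functor C C) (L : Functor A A) (ρ : LogicNat P T L)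
    -- two coalgebras
    {X₁ X₂ : Category.Obj C}
    (γ₁ : Category.Hom C X₁ (Functor.F₀ T X₁))
    (γ₂ : Category.Hom C X₂ (Functor.F₀ T X₂))
    -- a jointly mono span
    {B : Category.Obj C}
    (π₁ : Category.Hom C B X₁) (π₂ : Category.Hom C B X₂) →
    JointlyMono C π₁ π₂ →
    -- its dual span (pullback in A of P π₁ , P π₂)
    (B̄ : Category.Obj A)
    (π̄₁ : Category.Hom A B̄ (ContraFunctor.F₀ P X₁))
    (π̄₂ : Category.Hom A B̄ (ContraFunctor.F₀ P X₂)) →
    IsPullback A (ContraFunctor.F₁ P π₁) (ContraFunctor.F₁ P π₂) π̄₁ π̄₂ →
    -- the relation lifting T^ρ B (pullback in C of σ₁ , σ₂)
    (TρB : Category.Obj C)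
    (Tρπ₁ : Category.Hom C TρB (Functor.F₀ T X₁))
    (Tρπ₂ : Category.Hom C TρB (Functor.F₀ T X₂)) →
    IsPullback C (liftσ adj T L ρ π̄₁) (liftσ adj T L ρ π̄₂) Tρπ₁ Tρπ₂ →
    IsRhoBisimulation P T L ρ γ₁ γ₂ π₁ π₂ π̄₁ π̄₂
      ⇔ Σ (Category.Hom C B TρB) (λ δ →
            Category._≈_ C (Category._∘_ C Tρπ₁ δ) (Category._∘_ C γ₁ π₁)
          × Category._≈_ C (Category._∘_ C Tρπ₂ δ) (Category._∘_ C γ₂ π₂))
theorem3p17 C _ _ _ _ _ _ _ _ adj T L ρ γ₁ γ₂ π₁ π₂ _ _ π̄₁ π̄₂ _ _ _ _ TρB-pullback =
  IsPullback-factors⇔commutes C TρB-pullback (γ₁ ∘ π₁) (γ₂ ∘ π₂)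
    ⇔-∘ IsRhoBisimulation⇔liftσ-commutes adj T L ρ γ₁ γ₂ π₁ π₂ π̄₁ π̄₂
  where open Category C using (_∘_)
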